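{- For all integers $r\geq 2$ and $k_1,\dots,k_r\geq 3$, \[ M_r(k_1,\dots,k_r)\geq 3\binom{k_1+\cdots+k_r-2r}{k_1-2,\dots,k_r-2}. \]
   Context: For each integer $r\geq 2$, $M_r:\mathbb{Z}_{\geq 2}^r\to\mathbb{Z}_{\geq 0}$ denotes the family of functions uniquely determined by: (i) $M_2(k_1,k_2)=\binom{k_1+k_2-2}{k_1-1}$ for $k_1,k_2\geq 2$; (ii) for $r\geq 2$ and $k_1,\dots,k_r\geq 2$, inserting a coordinate equal to $2$ at any position of $(k_1,\dots,k_r)$ gives an $(r+1)$-tuple at which $M_{r+1}$ equals $M_r(k_1,\dots,k_r)$; (iii) for $k_1,\dots,k_r\geq 3$, $M_r(k_1,\dots,k_r)=\sum_{i=1}^r M_r(k_1,\dots,k_i-1,\dots,k_r)$ (the $i$-th coordinate decreased by $1$). The multinomial coefficient $\binom{n}{a_1,\dots,a_r}$ equals $\frac{n!}{a_1!\cdots a_r!}$. -}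

module Defs where

open import Data.Nat using (ℕ; zero; suc; _+_; _*_; _∸_; _≤_; NonZero; _!)
open import Data.Nat.Properties using (m*n≢0)
open import Data.Nat.DivMod using (_/_)
open import Data.Nat.Properties using (_!≢0)
open import Data.Vec using (Vec; []; _∷_; map; sum)

factProd : {r : ℕ} → Vec ℕ r → ℕ
factProd []       = 1
factProd (a ∷ as) = (a !) * factProd as

factProd≢0 : {r : ℕ} (as : Vec ℕ r) → NonZero (factProd as)
factProd≢0 []       = _
factProd≢0 (a ∷ as) = m*n≢0 (a !) (factProd as) {{a !≢0}} {{factProd≢0 as}}

multinomial : {r : ℕ} → ℕ → Vec ℕ r → ℕ
multinomial n as = (n ! / factProd as) {{factProd≢0 as}}

-- With a_i = k_i - 2 and n = a_1 + ... + a_r, we show 3 n! ≤ M_r(k) a_1! ⋯ a_r! by induction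
-- on n. The recurrence splits M_r(k) into r terms, and n! = Σ_i a_i (n-1)!, so it suffices to
-- bound the i-th term times a_1! ⋯ a_r! below by 3 a_i (n-1)!. If k_i ≥ 4 this is the
-- induction hypothesis at k with k_i lowered. If k_i = 3 the lowered coordinate is a 2, which
-- may be deleted: for r ≥ 3 the induction hypothesis applies to the other r - 1 coordinates,
-- and for r = 2 the term is M_2(2, k) = k ≥ 3 with n - 1 = k - 2.
module Submission where

open import Defs
open import Data.Nat using (ℕ; zero; suc; pred; _+_; _*_; _∸_; _≤_; _≥_; z≤n; s≤s; _!)
open import Data.Nat.Properties
open import Algebra.Properties.CommutativeSemigroup +-commutativeSemigroup
  using () renaming (x∙yz≈y∙xz to +-left-comm)
open import Algebra.Properties.CommutativeSemigroup *-commutativeSemigroup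
  using () renaming (x∙yz≈y∙xz to *-left-comm)
open import Data.Nat.Combinatorics using (_C_; nC1≡n; nCk≡nC[n∸k])
open import Data.Nat.DivMod using (m/n*n≤m)
open import Data.Fin using (Fin; zero; suc)
open import Data.Vec using (Vec; []; _∷_; insertAt; updateAt; removeAt; sum; tabulate; map; lookup)
open import Data.Vec.Properties using (map-insertAt; insertAt-removeAt; tabulate∘lookup; tabulate-∘)
open import Data.Vec.Relation.Unary.All using (All; []; _∷_)
import Data.Vec.Relation.Unary.All as All
open import Data.Vec.Relation.Unary.All.Properties using (lookup⁺)
open import Function using (_∘_)
open import Relation.Binary.PropositionalEquality

private
  variable
    A B : Set
    r : ℕ

nC[n∸1]≡n : ∀ {n} → 1 ≤ n → n C (n ∸ 1) ≡ n
nC[n∸1]≡n {n} 1≤n = begin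
  n C (n ∸ 1)       ≡⟨ nCk≡nC[n∸k] (m∸n≤m n 1) ⟩
  n C (n ∸ (n ∸ 1)) ≡⟨ cong (n C_) (m∸[m∸n]≡n 1≤n) ⟩
  n C 1             ≡⟨ nC1≡n n ⟩
  n                 ∎
  where open ≡-Reasoning

updateAt-insertAt : ∀ (xs : Vec A r) i x (f : A → A) →
                    updateAt (insertAt xs i x) i f ≡ insertAt xs i (f x)
updateAt-insertAt xs       zero    x f = refl
updateAt-insertAt (y ∷ xs) (suc i) x f = cong (y ∷_) (updateAt-insertAt xs i x f)

map-is-tabulate : ∀ (f : A → B) (xs : Vec A r) → map f xs ≡ tabulate (f ∘ lookup xs)
map-is-tabulate f xs =
  trans (cong (map f) (sym (tabulate∘lookup xs))) (sym (tabulate-∘ f (lookup xs)))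

insertAt⁺ : ∀ {P : A → Set} {xs : Vec A r} i {x} → P x → All P xs → All P (insertAt xs i x)
insertAt⁺ zero    px pxs        = px ∷ pxs
insertAt⁺ (suc i) px (py ∷ pxs) = py ∷ insertAt⁺ i px pxs

removeAt⁺ : ∀ {P : A → Set} {xs : Vec A (suc r)} → All P xs → ∀ i → All P (removeAt xs i)
removeAt⁺                  (px ∷ pxs) zero    = pxs
removeAt⁺ {xs = _ ∷ _ ∷ _} (px ∷ pxs) (suc i) = px ∷ removeAt⁺ pxs i

sum-insertAt : ∀ (xs : Vec ℕ r) i x → sum (insertAt xs i x) ≡ x + sum xs
sum-insertAt xs       zero    x = refl
sum-insertAt (y ∷ xs) (suc i) x = trans (cong (y +_) (sum-insertAt xs i x)) (+-left-comm y x (sum xs))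

factProd-insertAt : ∀ (xs : Vec ℕ r) i x → factProd (insertAt xs i x) ≡ x ! * factProd xs
factProd-insertAt xs       zero    x = refl
factProd-insertAt (y ∷ xs) (suc i) x =
  trans (cong (y ! *_) (factProd-insertAt xs i x)) (*-left-comm (y !) (x !) (factProd xs))

sum-tabulate-*ʳ : ∀ (f : Fin r → ℕ) c → sum (tabulate f) * c ≡ sum (tabulate (λ i → f i * c))
sum-tabulate-*ʳ {zero}  f c = refl
sum-tabulate-*ʳ {suc r} f c =
  trans (*-distribʳ-+ c (f zero) _) (cong (f zero * c +_) (sum-tabulate-*ʳ (f ∘ suc) c))

sum-tabulate-mono-≤ : ∀ {f g : Fin r → ℕ} → (∀ i → f i ≤ g i) → sum (tabulate f) ≤ sum (tabulate g)
sum-tabulate-mono-≤ {zero}  f≤g = z≤n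
sum-tabulate-mono-≤ {suc r} f≤g = +-mono-≤ (f≤g zero) (sum-tabulate-mono-≤ (f≤g ∘ suc))

sum-lower-bound : ∀ {c} (ks : Vec ℕ r) → All (c ≤_) ks → c * r ≤ sum ks
sum-lower-bound {c = c} []       []         = ≤-reflexive (*-zeroʳ c)
sum-lower-bound {c = c} (k ∷ ks) (c≤k ∷ cs) = begin
  c * suc _   ≡⟨ *-suc c _ ⟩
  c + c * _   ≤⟨ +-mono-≤ c≤k (sum-lower-bound ks cs) ⟩
  k + sum ks  ∎
  where open ≤-Reasoning

sum-∸ : ∀ {c} (ks : Vec ℕ r) → All (c ≤_) ks → sum ks ∸ c * r ≡ sum (map (_∸ c) ks)
sum-∸ {c = c} []       []         = 0∸n≡0 (c * 0)
sum-∸ {suc r} {c} (k ∷ ks) (c≤k ∷ cs) = begin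
  k + sum ks ∸ c * suc r        ≡⟨ cong (k + sum ks ∸_) (*-suc c r) ⟩
  k + sum ks ∸ (c + c * r)      ≡⟨ ∸-+-assoc (k + sum ks) c (c * r) ⟨
  k + sum ks ∸ c ∸ c * r        ≡⟨ cong (_∸ c * r) (+-∸-comm (sum ks) c≤k) ⟩
  k ∸ c + sum ks ∸ c * r        ≡⟨ +-∸-assoc (k ∸ c) (sum-lower-bound ks cs) ⟩
  k ∸ c + (sum ks ∸ c * r)      ≡⟨ cong (k ∸ c +_) (sum-∸ ks cs) ⟩
  k ∸ c + sum (map (_∸ c) ks)   ∎
  where open ≡-Reasoning

excess : Vec ℕ r → Vec ℕ r
excess = map (_∸ 2)

sum-excess-insertAt : ∀ (ks : Vec ℕ r) i k → sum (excess (insertAt ks i k)) ≡ k ∸ 2 + sum (excess ks)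
sum-excess-insertAt ks i k = trans (cong sum (map-insertAt (_∸ 2) k ks i)) (sum-insertAt (excess ks) i (k ∸ 2))

factProd-excess-insertAt : ∀ (ks : Vec ℕ r) i k →
                           factProd (excess (insertAt ks i k)) ≡ (k ∸ 2) ! * factProd (excess ks)
factProd-excess-insertAt ks i k =
  trans (cong factProd (map-insertAt (_∸ 2) k ks i)) (factProd-insertAt (excess ks) i (k ∸ 2))

multinomial-bound : ∀ c n {m} (as : Vec ℕ r) → c * n ! ≤ m * factProd as → c * multinomial n as ≤ m
multinomial-bound c n {m} as c*n!≤ =
  *-cancelʳ-≤ (c * multinomial n as) m (factProd as) {{factProd≢0 as}} (begin
    c * multinomial n as * factProd as    ≡⟨ *-assoc c (multinomial n as) (factProd as) ⟩
    c * (multinomial n as * factProd as)  ≤⟨ *-monoʳ-≤ c (m/n*n≤m (n !) (factProd as) {{factProd≢0 as}}) ⟩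
    c * n !                               ≤⟨ c*n!≤ ⟩
    m * factProd as                       ∎)
  where open ≤-Reasoning

module _ (M : (r : ℕ) → Vec ℕ r → ℕ)
  (M₂-binomial : ∀ a b → 2 ≤ a → 2 ≤ b → M 2 (a ∷ b ∷ []) ≡ (a + b ∸ 2) C (a ∸ 1))
  (M-insert-2 : ∀ r → 2 ≤ r → (ks : Vec ℕ r) → All (2 ≤_) ks → (i : Fin (suc r))
    → M (suc r) (insertAt ks i 2) ≡ M r ks)
  (M-recurrence : ∀ r → 2 ≤ r → (ks : Vec ℕ r) → All (3 ≤_) ks
    → M r ks ≡ sum (tabulate (λ i → M r (updateAt ks i pred))))
  where

  M₂-with-2 : ∀ k → 2 ≤ k → (i : Fin 2) → M 2 (insertAt (k ∷ []) i 2) ≡ k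
  M₂-with-2 k 2≤k zero       = trans (M₂-binomial 2 k ≤-refl 2≤k) (nC1≡n k)
  M₂-with-2 k 2≤k (suc zero) = begin
    M 2 (k ∷ 2 ∷ [])        ≡⟨ M₂-binomial k 2 2≤k ≤-refl ⟩
    (k + 2 ∸ 2) C (k ∸ 1)   ≡⟨ cong (_C (k ∸ 1)) (m+n∸n≡m k 2) ⟩
    k C (k ∸ 1)             ≡⟨ nC[n∸1]≡n (≤-trans (s≤s z≤n) 2≤k) ⟩
    k                       ∎
    where open ≡-Reasoning

  M-lower-bound : ∀ n {r} → 2 ≤ r → (ks : Vec ℕ r) → All (3 ≤_) ks → sum (excess ks) ≡ n
        → 3 * n ! ≤ M r ks * factProd (excess ks)

  M-lower-bound-term : ∀ m (ks : Vec ℕ (suc r)) i k → All (3 ≤_) ks → 3 ≤ k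
             → sum (excess (insertAt ks i k)) ≡ suc m
             → (k ∸ 2) * (3 * m !)
               ≤ M (2 + r) (updateAt (insertAt ks i k) i pred) * factProd (excess (insertAt ks i k))

  M-lower-bound-with-2 : ∀ m (ks : Vec ℕ (suc r)) i → All (3 ≤_) ks → sum (excess ks) ≡ m
               → 3 * m ! ≤ M (2 + r) (insertAt ks i 2) * factProd (excess ks)

  M-lower-bound zero    (s≤s (s≤s _)) (_ ∷ _) (s≤s (s≤s (s≤s _)) ∷ _) ()
  M-lower-bound (suc m) {2+r} r≥2@(s≤s (s≤s _)) ks ks≥3 Σa≡1+m = begin
    3 * suc m !
      ≡⟨ *-left-comm 3 (suc m) (m !) ⟩
    suc m * (3 * m !)
      ≡⟨ cong (_* (3 * m !)) (sym Σa≡1+m) ⟩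
    sum (excess ks) * (3 * m !)
      ≡⟨ trans (cong (λ v → sum v * (3 * m !)) (map-is-tabulate (_∸ 2) ks))
               (sum-tabulate-*ʳ (λ i → lookup ks i ∸ 2) (3 * m !)) ⟩
    sum (tabulate (λ i → (lookup ks i ∸ 2) * (3 * m !)))
      ≤⟨ sum-tabulate-mono-≤ term ⟩
    sum (tabulate (λ i → M 2+r (updateAt ks i pred) * factProd (excess ks)))
      ≡⟨ sum-tabulate-*ʳ (λ i → M 2+r (updateAt ks i pred)) (factProd (excess ks)) ⟨
    sum (tabulate (λ i → M 2+r (updateAt ks i pred))) * factProd (excess ks)
      ≡⟨ cong (_* factProd (excess ks)) (M-recurrence 2+r r≥2 ks ks≥3) ⟨
    M 2+r ks * factProd (excess ks)
      ∎
    where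
    open ≤-Reasoning
    term : ∀ i → (lookup ks i ∸ 2) * (3 * m !) ≤ M 2+r (updateAt ks i pred) * factProd (excess ks)
    term i = subst (λ v → (lookup ks i ∸ 2) * (3 * m !) ≤ M 2+r (updateAt v i pred) * factProd (excess v))
      (insertAt-removeAt ks i)
      (M-lower-bound-term m (removeAt ks i) i (lookup ks i) (removeAt⁺ ks≥3 i) (lookup⁺ ks≥3 i)
        (trans (cong (sum ∘ excess) (insertAt-removeAt ks i)) Σa≡1+m))

  M-lower-bound-term m ks i 1 _ (s≤s ()) _
  M-lower-bound-term m ks i 2 _ (s≤s (s≤s ())) _
  M-lower-bound-term {r} m ks i 3 ks≥3 _ Σa≡1+m = begin
    1 * (3 * m !)
      ≡⟨ *-identityˡ _ ⟩
    3 * m !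
      ≤⟨ M-lower-bound-with-2 m ks i ks≥3 (suc-injective (trans (sym (sum-excess-insertAt ks i 3)) Σa≡1+m)) ⟩
    M (2 + r) (insertAt ks i 2) * factProd (excess ks)
      ≡⟨ cong₂ _*_ (cong (M (2 + r)) (updateAt-insertAt ks i 3 pred))
                   (trans (factProd-excess-insertAt ks i 3) (*-identityˡ _)) ⟨
    M (2 + r) (updateAt (insertAt ks i 3) i pred) * factProd (excess (insertAt ks i 3))
      ∎
    where open ≤-Reasoning
  M-lower-bound-term {r} m ks i k@(suc k-1@(suc (suc (suc _)))) ks≥3 _ Σa≡1+m = begin
    (k ∸ 2) * (3 * m !)
      ≤⟨ *-monoʳ-≤ (k ∸ 2) (M-lower-bound m (s≤s (s≤s z≤n)) ks′ ks′≥3 Σa′≡m) ⟩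
    (k ∸ 2) * (M (2 + r) ks′ * factProd (excess ks′))
      ≡⟨ *-left-comm (k ∸ 2) (M (2 + r) ks′) _ ⟩
    M (2 + r) ks′ * ((k ∸ 2) * factProd (excess ks′))
      ≡⟨ cong (M (2 + r) ks′ *_) Πa≡ ⟩
    M (2 + r) ks′ * factProd (excess (insertAt ks i k))
      ≡⟨ cong (λ v → M (2 + r) v * factProd (excess (insertAt ks i k))) (updateAt-insertAt ks i k pred) ⟨
    M (2 + r) (updateAt (insertAt ks i k) i pred) * factProd (excess (insertAt ks i k))
      ∎
    where
    open ≤-Reasoning
    ks′ = insertAt ks i k-1
    ks′≥3 : All (3 ≤_) ks′
    ks′≥3 = insertAt⁺ i (s≤s (s≤s (s≤s z≤n))) ks≥3
    Πa≡ : (k ∸ 2) * factProd (excess ks′) ≡ factProd (excess (insertAt ks i k))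
    Πa≡ = begin-equality
      (k ∸ 2) * factProd (excess ks′)               ≡⟨ cong ((k ∸ 2) *_) (factProd-excess-insertAt ks i k-1) ⟩
      (k ∸ 2) * ((k-1 ∸ 2) ! * factProd (excess ks)) ≡⟨ *-assoc (k ∸ 2) ((k-1 ∸ 2) !) _ ⟨
      (k ∸ 2) ! * factProd (excess ks)              ≡⟨ factProd-excess-insertAt ks i k ⟨
      factProd (excess (insertAt ks i k))           ∎
    Σa′≡m : sum (excess ks′) ≡ m
    Σa′≡m = suc-injective (begin-equality
      suc (sum (excess ks′))             ≡⟨ cong suc (sum-excess-insertAt ks i k-1) ⟩
      k ∸ 2 + sum (excess ks)            ≡⟨ sum-excess-insertAt ks i k ⟨
      sum (excess (insertAt ks i k))     ≡⟨ Σa≡1+m ⟩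
      suc m                              ∎)

  M-lower-bound-with-2 {zero} _ (k ∷ []) i (k≥3 ∷ []) refl = begin
    3 * (k ∸ 2 + 0) !
      ≡⟨ cong (λ n → 3 * n !) (+-identityʳ (k ∸ 2)) ⟩
    3 * (k ∸ 2) !
      ≤⟨ *-monoˡ-≤ ((k ∸ 2) !) k≥3 ⟩
    k * (k ∸ 2) !
      ≡⟨ cong₂ _*_ (M₂-with-2 k (<⇒≤ k≥3) i) (*-identityʳ _) ⟨
    M 2 (insertAt (k ∷ []) i 2) * ((k ∸ 2) ! * 1)
      ∎
    where open ≤-Reasoning
  M-lower-bound-with-2 {suc r} m ks i ks≥3 Σa≡m = begin
    3 * m !
      ≤⟨ M-lower-bound m (s≤s (s≤s z≤n)) ks ks≥3 Σa≡m ⟩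
    M (2 + r) ks * factProd (excess ks)
      ≡⟨ cong (_* factProd (excess ks)) (M-insert-2 (2 + r) (s≤s (s≤s z≤n)) ks (All.map <⇒≤ ks≥3) i) ⟨
    M (3 + r) (insertAt ks i 2) * factProd (excess ks)
      ∎
    where open ≤-Reasoning

corollary3p5 : (M : (r : ℕ) → Vec ℕ r → ℕ)
    → (∀ a b → 2 ≤ a → 2 ≤ b → M 2 (a ∷ b ∷ []) ≡ (a + b ∸ 2) C (a ∸ 1))
    → (∀ r → 2 ≤ r → (ks : Vec ℕ r) → All (2 ≤_) ks → (i : Fin (suc r))
         → M (suc r) (insertAt ks i 2) ≡ M r ks)
    → (∀ r → 2 ≤ r → (ks : Vec ℕ r) → All (3 ≤_) ks
         → M r ks ≡ sum (tabulate (λ i → M r (updateAt ks i pred))))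
    → ∀ r → 2 ≤ r → (ks : Vec ℕ r) → All (3 ≤_) ks
    → M r ks ≥ 3 * multinomial (sum ks ∸ 2 * r) (map (λ k → k ∸ 2) ks)
corollary3p5 M M₂-binomial M-insert-2 M-recurrence r r≥2 ks ks≥3 =
  subst (λ n → M r ks ≥ 3 * multinomial n (excess ks)) (sym (sum-∸ {c = 2} ks (All.map <⇒≤ ks≥3)))
    (multinomial-bound 3 (sum (excess ks)) (excess ks)
      (M-lower-bound M M₂-binomial M-insert-2 M-recurrence (sum (excess ks)) r≥2 ks ks≥3 refl))
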